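{- Let $A$ be a finite abelian group and $A'$ a subgroup of $A$. Then the K\"ohler graph of $A'$ is isomorphic to a union of connected components of the K\"ohler graph of $A$. In particular, every connected component of the K\"ohler graph of $A$ is isomorphic to a connected component of the K\"ohler graph of a subgroup of $A$ generated by two elements.
   Context: For a finite abelian group $A$ (additive), $\hat A$ is the permutation group on $A$ generated by translations $x\mapsto x+a$ and $x\mapsto -x$; $[a_1,\dots,a_t]$ denotes the $\hat A$-orbit $\{\{0,a_1,\dots,a_t\}+c\}_{c\in A}\cup\{ -\{0,a_1,\dots,a_t\}+c\}_{c\in A}$. Let $\mathcal T=\{[a,b]: a,b\in A,\ a\ne\pm b,\ 2a\notin\{0,b,2b\},\ 2b\notin\{0,a,2a\}\}$ and $\mathcal E=\{[a,b,a+b]: a,b\in A,\ 0\notin\{2a,2b\},\ \{\pm a,\pm 2a\}\cap\{\pm b,\pm 2b\}=\emptyset\}$. The K\"ohler graph of $A$ has vertex set $\mathcal T$ and edge set $\mathcal E$, the orbit of a triple $T$ being incident with the orbit of a quadruple $B$ if $B\supseteq T'$ for some $T'$ in the orbit of $T$; each edge is incident with exactly two vertices and there are no multiple edges, so it is a simple graph. The K\"ohler graph of a subgroup is defined in the same way with that subgroup in place of $A$. -}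

module Defs where

open import Algebra.Structures using (IsAbelianGroup)
open import Data.Fin using (Fin)
open import Data.Nat using (ℕ; zero; suc)
open import Data.Integer using (ℤ; +_; -[1+_])
open import Data.Product using (Σ; ∃; ∃₂; _×_; _,_)
open import Data.Sum using (_⊎_)
open import Data.Unit using (⊤)
open import Data.Empty using (⊥)
open import Function.Bundles using (_↔_; _⇔_)
open import Relation.Binary.PropositionalEquality using (_≡_)
open import Relation.Nullary using (¬_)

record FinAbGroup : Set₁ where
  infixl 6 _+_
  field
    Carrier        : Set
    _+_            : Carrier → Carrier → Carrier
    0#             : Carrier
    -_             : Carrier → Carrier
    isAbelianGroup : IsAbelianGroup _≡_ _+_ 0# -_
    finite         : ∃ λ n → Carrier ↔ Fin n

-- Vertices and edges are given by representatives together with the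
-- equivalence relation "same orbit"; incidence is a relation between
-- representatives (in the Köhler graph it only depends on the orbits).

record Graph : Set₁ where
  field
    V     : Set
    E     : Set
    _≈V_  : V → V → Set
    _≈E_  : E → E → Set
    _∈E_  : V → E → Set

record Iso (G H : Graph) : Set where
  module G = Graph G
  module H = Graph H
  field
    fV      : G.V → H.V
    fE      : G.E → H.E
    fV-cong : ∀ {u v} → u G.≈V v → fV u H.≈V fV v
    fV-inj  : ∀ {u v} → fV u H.≈V fV v → u G.≈V v
    fV-surj : ∀ v′ → ∃ λ v → fV v H.≈V v′
    fE-cong : ∀ {e f} → e G.≈E f → fE e H.≈E fE f
    fE-inj  : ∀ {e f} → fE e H.≈E fE f → e G.≈E f
    fE-surj : ∀ e′ → ∃ λ e → fE e H.≈E e′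
    inc     : ∀ v e → (v G.∈E e) ⇔ (fV v H.∈E fE e)

-- G is isomorphic to a union of connected components of H:
-- an isomorphism of G onto its image in H, where the image is closed
-- under incidence (every edge of H meeting an image vertex, and every
-- vertex of H lying on an image edge, belongs to the image).
record IsoToUnionOfComponents (G H : Graph) : Set where
  module G = Graph G
  module H = Graph H
  field
    fV       : G.V → H.V
    fE       : G.E → H.E
    fV-cong  : ∀ {u v} → u G.≈V v → fV u H.≈V fV v
    fV-inj   : ∀ {u v} → fV u H.≈V fV v → u G.≈V v
    fE-cong  : ∀ {e f} → e G.≈E f → fE e H.≈E fE f
    fE-inj   : ∀ {e f} → fE e H.≈E fE f → e G.≈E f
    inc      : ∀ v e → (v G.∈E e) ⇔ (fV v H.∈E fE e)
    closedE  : ∀ v e′ → fV v H.∈E e′ → ∃ λ e → fE e H.≈E e′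
    closedV  : ∀ v′ e → v′ H.∈E fE e → ∃ λ v → fV v H.≈V v′

module _ (G : Graph) where
  open Graph G

  data Reach (v : V) : V → Set where
    here : ∀ {u} → v ≈V u → Reach v u
    step : ∀ {u w} (e : E) → Reach v u → u ∈E e → w ∈E e → Reach v w

  Component : V → Graph
  Component v = record
    { V    = Σ V (Reach v)
    ; E    = Σ E (λ e → ∃ λ u → Reach v u × u ∈E e)
    ; _≈V_ = λ { (u , _) (u′ , _) → u ≈V u′ }
    ; _≈E_ = λ { (e , _) (e′ , _) → e ≈E e′ }
    ; _∈E_ = λ { (u , _) (e , _) → u ∈E e }
    }

module _ (A : FinAbGroup) where
  open FinAbGroup A

  Subset : Set₁
  Subset = Carrier → Set

  record IsSubgroup (S : Subset) : Set where
    field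
      has-0 : S 0#
      +-closed : ∀ {x y} → S x → S y → S (x + y)
      neg-closed : ∀ {x} → S x → S (- x)

  Whole : Subset
  Whole _ = ⊤

  _·ℕ_ : ℕ → Carrier → Carrier
  zero  ·ℕ x = 0#
  suc n ·ℕ x = x + (n ·ℕ x)

  _·ℤ_ : ℤ → Carrier → Carrier
  (+ n)    ·ℤ x = n ·ℕ x
  -[1+ n ] ·ℤ x = - (suc n ·ℕ x)

  Generated : Carrier → Carrier → Subset
  Generated a b x = ∃₂ λ (m n : ℤ) → x ≡ (m ·ℤ a) + (n ·ℤ b)

  -- elements of Â : x ↦ x + c  and  x ↦ - x + c
  data Sign : Set where
    plus minus : Sign

  act : Sign → Carrier → Carrier → Carrier
  act plus  c x = x + c
  act minus c x = (- x) + c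

  Image : (Carrier → Carrier) → Subset → Subset
  Image g X y = ∃ λ x → X x × y ≡ g x

  SameSet : Subset → Subset → Set
  SameSet X Y = ∀ y → X y ⇔ Y y

  Triple : Carrier → Carrier → Subset
  Triple a b x = x ≡ 0# ⊎ x ≡ a ⊎ x ≡ b

  Quad : Carrier → Carrier → Subset
  Quad a b x = x ≡ 0# ⊎ x ≡ a ⊎ x ≡ b ⊎ x ≡ a + b

  Disjoint : Subset → Subset → Set
  Disjoint X Y = ∀ x → X x → Y x → ⊥

  TCond : Carrier → Carrier → Set
  TCond a b =
    ¬ a ≡ b × ¬ a ≡ - b ×
    ¬ a + a ≡ 0# × ¬ a + a ≡ b × ¬ a + a ≡ b + b ×
    ¬ b + b ≡ 0# × ¬ b + b ≡ a × ¬ b + b ≡ a + a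

  ECond : Carrier → Carrier → Set
  ECond a b =
    ¬ a + a ≡ 0# × ¬ b + b ≡ 0# ×
    Disjoint (λ x → x ≡ a ⊎ x ≡ - a ⊎ x ≡ a + a ⊎ x ≡ - (a + a))
             (λ x → x ≡ b ⊎ x ≡ - b ⊎ x ≡ b + b ⊎ x ≡ - (b + b))

  module _ (S : Subset) where

    InOrbit : Subset → Subset → Set
    InOrbit X Y = ∃ λ s → ∃ λ c → S c × SameSet Y (Image (act s c) X)

    record KVertex : Set where
      constructor kv
      field
        a b  : Carrier
        a∈S  : S a
        b∈S  : S b
        cond : TCond a b

    record KEdge : Set where
      constructor ke
      field
        a b  : Carrier
        a∈S  : S a
        b∈S  : S b
        cond : ECond a b

    Köhler : Graph
    Köhler = record
      { V    = KVertex
      ; E    = KEdge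
      ; _≈V_ = λ u v → InOrbit (Triple (KVertex.a u) (KVertex.b u))
                               (Triple (KVertex.a v) (KVertex.b v))
      ; _≈E_ = λ e f → InOrbit (Quad (KEdge.a e) (KEdge.b e))
                               (Quad (KEdge.a f) (KEdge.b f))
      ; _∈E_ = λ v e → ∃ λ s → ∃ λ c → S c ×
                 (∀ x → Triple (KVertex.a v) (KVertex.b v) x
                      → Quad (KEdge.a e) (KEdge.b e) (act s c x))
      }

-- The Köhler graph of S embeds into that of A: an Â-translate matching two subsets of S that
-- contain 0 sends some element of S to 0, so its offset lies in S and it belongs to Â_S. The image
-- is closed under incidence. A vertex on an edge spanned inside S lies in S. Conversely, if g ∈ Â
-- maps a triple {0,u₁,u₂} ⊆ S into {0,a,b,a+b}, then g(0) lies in this quadruple, and recentring it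
-- there writes it as g(0) + {0,a′,b′,a′+b′} with ECond preserved; this new quadruple contains the
-- distinct nonzero elements ±u₁, ±u₂ of S, which forces a′, b′ ∈ S. An embedding onto a union of
-- components restricts to isomorphisms between components; for the second part apply it to the
-- subgroup generated by a and b, where [a,b] is a vertex of the given component.
module Submission where

open import Defs
open import Algebra.Bundles using (AbelianGroup)
open import Algebra.Structures using (IsAbelianGroup)
import Algebra.Properties.AbelianGroup as AbelianGroupProperties
import Algebra.Properties.CommutativeSemigroup as CommutativeSemigroupProperties
open import Data.Empty using (⊥-elim)
open import Data.Integer as ℤ using (-[1+_]; _⊖_)
import Data.Integer.Properties as ℤ
open import Data.Nat as ℕ using (zero; suc)
import Data.Nat.Properties as ℕ
open import Data.Product using (Σ; ∃; ∃₂; _×_; _,_; proj₁; proj₂)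
open import Data.Sum using (_⊎_; inj₁; inj₂)
open import Data.Unit using (tt)
open import Function.Bundles using (mk⇔; Equivalence)
open import Relation.Binary.Definitions using (Reflexive)
open import Relation.Binary.Structures using (IsEquivalence)
open import Relation.Binary.PropositionalEquality
open import Relation.Nullary using (¬_)

record IsSetoidGraph (G : Graph) : Set where
  open Graph G
  field
    ≈V-isEquivalence : IsEquivalence _≈V_
    ≈E-isEquivalence : IsEquivalence _≈E_
    ∈E-respˡ         : ∀ {u u′ e} → u ≈V u′ → u ∈E e → u′ ∈E e
    ∈E-respʳ         : ∀ {u e e′} → e ≈E e′ → u ∈E e → u ∈E e′

module _ {G H : Graph} (≈V-reflG : Reflexive (Graph._≈V_ G)) (setoidH : IsSetoidGraph H)
         (F : IsoToUnionOfComponents G H) where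
  private
    module G = Graph G
    module H = Graph H
    module F = IsoToUnionOfComponents F
    open IsSetoidGraph setoidH
    module ≈V = IsEquivalence ≈V-isEquivalence
    module ≈E = IsEquivalence ≈E-isEquivalence

  edge-preimage : ∀ {u e} → F.fV u H.∈E e → Σ G.E λ e′ → F.fE e′ H.≈E e × u G.∈E e′
  edge-preimage {u} {e} u∈e with F.closedE u e u∈e
  ... | e′ , e′↦e = e′ , e′↦e , Equivalence.from (F.inc u e′) (∈E-respʳ (≈E.sym e′↦e) u∈e)

  module _ {v : H.V} {w : G.V} (w↦v : F.fV w H.≈V v) where

    ReachablePreimage : H.V → Set
    ReachablePreimage u = Σ G.V λ u′ → Reach G w u′ × F.fV u′ H.≈V u

    lift : ∀ {u} → Reach H v u → ReachablePreimage u
    lift (here v≈u) = w , here ≈V-reflG , ≈V.trans w↦v v≈u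
    lift (step e r u∈e x∈e) with lift r
    ... | u′ , r′ , u′↦u with edge-preimage (∈E-respˡ (≈V.sym u′↦u) u∈e)
    ... | e′ , e′↦e , u′∈e′ with F.closedV _ e′ (∈E-respʳ (≈E.sym e′↦e) x∈e)
    ... | x′ , x′↦x = x′ , step e′ r′ u′∈e′ x′∈e′ , x′↦x
      where
        x′∈e′ : x′ G.∈E e′
        x′∈e′ = Equivalence.from (F.inc x′ e′) (∈E-respˡ (≈V.sym x′↦x) (∈E-respʳ (≈E.sym e′↦e) x∈e))

    push : ∀ {x} → Reach G w x → Reach H v (F.fV x)
    push (here w≈x)         = here (≈V.trans (≈V.sym w↦v) (F.fV-cong w≈x))
    push (step e r x∈e y∈e) =
      step (F.fE e) (push r) (Equivalence.to (F.inc _ e) x∈e) (Equivalence.to (F.inc _ e) y∈e)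

    private
      module CH = Graph (Component H v)
      module CG = Graph (Component G w)

    liftV : CH.V → CG.V
    liftV (u , r) = let (u′ , r′ , _) = lift r in u′ , r′

    liftV↦ : ∀ x → F.fV (proj₁ (liftV x)) H.≈V proj₁ x
    liftV↦ (u , r) = let (_ , _ , u′↦u) = lift r in u′↦u

    lift-edge : ∀ {u} e (r : Reach H v u) → u H.∈E e →
                Σ G.E λ e′ → F.fE e′ H.≈E e × proj₁ (liftV (u , r)) G.∈E e′
    lift-edge e r u∈e = edge-preimage (∈E-respˡ (≈V.sym (liftV↦ (_ , r))) u∈e)

    liftE : CH.E → CG.E
    liftE (e , u , r , u∈e) =
      let (u′ , r′) = liftV (u , r); (e′ , _ , u′∈e′) = lift-edge e r u∈e in e′ , u′ , r′ , u′∈e′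

    liftE↦ : ∀ y → F.fE (proj₁ (liftE y)) H.≈E proj₁ y
    liftE↦ (e , u , r , u∈e) = let (_ , e′↦e , _) = lift-edge e r u∈e in e′↦e

    component-iso : Iso (Component H v) (Component G w)
    component-iso = record
      { fV      = liftV
      ; fE      = liftE
      ; fV-cong = λ {x} {y} x≈y → F.fV-inj (≈V.trans (liftV↦ x) (≈V.trans x≈y (≈V.sym (liftV↦ y))))
      ; fV-inj  = λ {x} {y} p → ≈V.trans (≈V.sym (liftV↦ x)) (≈V.trans (F.fV-cong p) (liftV↦ y))
      ; fV-surj = λ { (u′ , r′) → (F.fV u′ , push r′) , F.fV-inj (liftV↦ (F.fV u′ , push r′)) }
      ; fE-cong = λ {x} {y} x≈y → F.fE-inj (≈E.trans (liftE↦ x) (≈E.trans x≈y (≈E.sym (liftE↦ y))))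
      ; fE-inj  = λ {x} {y} p → ≈E.trans (≈E.sym (liftE↦ x)) (≈E.trans (F.fE-cong p) (liftE↦ y))
      ; fE-surj = λ { (e′ , u′ , r′ , u′∈e′) →
          let y = F.fE e′ , F.fV u′ , push r′ , Equivalence.to (F.inc u′ e′) u′∈e′
          in y , F.fE-inj (liftE↦ y) }
      ; inc     = λ x y → mk⇔
          (λ x∈y → Equivalence.from (F.inc _ _) (∈E-respʳ (≈E.sym (liftE↦ y)) (∈E-respˡ (≈V.sym (liftV↦ x)) x∈y)))
          (λ x′∈y′ → ∈E-respˡ (liftV↦ x) (∈E-respʳ (liftE↦ y) (Equivalence.to (F.inc _ _) x′∈y′)))
      }

pattern quad-0   = inj₁ refl
pattern quad-a   = inj₂ (inj₁ refl)
pattern quad-b   = inj₂ (inj₂ (inj₁ refl))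
pattern quad-a+b = inj₂ (inj₂ (inj₂ refl))

module KöhlerGraph (A : FinAbGroup) where
  open FinAbGroup A
  open IsAbelianGroup isAbelianGroup using (assoc; comm; identityˡ; identityʳ; inverseˡ; inverseʳ)

  abelianGroup : AbelianGroup _ _
  abelianGroup = record
    { Carrier = Carrier ; _≈_ = _≡_ ; _∙_ = _+_ ; ε = 0# ; _⁻¹ = -_ ; isAbelianGroup = isAbelianGroup }

  open AbelianGroupProperties abelianGroup
    using (⁻¹-involutive; ⁻¹-injective; ε⁻¹≈ε; ⁻¹-∙-comm
          ; \\-leftDividesˡ; \\-leftDividesʳ; //-rightDividesˡ; //-rightDividesʳ)
  open CommutativeSemigroupProperties (AbelianGroup.commutativeSemigroup abelianGroup) using (interchange)

  -x+y+x≡y : ∀ x y → - x + y + x ≡ y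
  -x+y+x≡y x y = trans (comm (- x + y) x) (\\-leftDividesˡ x y)

  -y+[x+y]≡x : ∀ x y → - y + (x + y) ≡ x
  -y+[x+y]≡x x y = trans (cong ((- y) +_) (comm x y)) (\\-leftDividesʳ y x)

  -x+-y+[x+y]≡0 : ∀ x y → - x + - y + (x + y) ≡ 0#
  -x+-y+[x+y]≡0 x y = trans (cong (_+ (x + y)) (⁻¹-∙-comm x y)) (inverseˡ (x + y))

  -[x+x]≡-x+-x : ∀ x → - (x + x) ≡ - x + - x
  -[x+x]≡-x+-x x = sym (⁻¹-∙-comm x x)

  x+x≢0⇒x≢0 : ∀ {x} → ¬ x + x ≡ 0# → ¬ x ≡ 0#
  x+x≢0⇒x≢0 x+x≢0 refl = x+x≢0 (identityˡ 0#)

  _⊙_ : Sign A → Sign A → Sign A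
  plus  ⊙ s     = s
  minus ⊙ plus  = minus
  minus ⊙ minus = plus

  offset⁻¹ : Sign A → Carrier → Carrier
  offset⁻¹ plus  c = - c
  offset⁻¹ minus c = c

  act-0# : ∀ s c → act A s c 0# ≡ c
  act-0# plus  c = identityˡ c
  act-0# minus c = trans (cong (_+ c) ε⁻¹≈ε) (identityˡ c)

  act-linear-part : ∀ s c x → act A s c x ≡ act A s 0# x + c
  act-linear-part plus  c x = cong (_+ c) (sym (identityʳ x))
  act-linear-part minus c x = cong (_+ c) (sym (identityʳ (- x)))

  act-∘ : ∀ s c s′ c′ x → act A s c (act A s′ c′ x) ≡ act A (s ⊙ s′) (act A s c c′) x
  act-∘ plus  c plus  c′ x = assoc x c′ c
  act-∘ plus  c minus c′ x = assoc (- x) c′ c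
  act-∘ minus c plus  c′ x = trans (cong (_+ c) (sym (⁻¹-∙-comm x c′))) (assoc (- x) (- c′) c)
  act-∘ minus c minus c′ x = begin
    - (- x + c′) + c       ≡⟨ cong (_+ c) (sym (⁻¹-∙-comm (- x) c′)) ⟩
    - - x + - c′ + c       ≡⟨ cong (λ t → t + - c′ + c) (⁻¹-involutive x) ⟩
    x + - c′ + c           ≡⟨ assoc x (- c′) c ⟩
    x + (- c′ + c)         ∎
    where open ≡-Reasoning

  act-inverse : ∀ s c x → act A s (offset⁻¹ s c) (act A s c x) ≡ x
  act-inverse plus  c x = //-rightDividesʳ c x
  act-inverse minus c x = begin
    - (- x + c) + c       ≡⟨ cong (_+ c) (sym (⁻¹-∙-comm (- x) c)) ⟩
    - - x + - c + c       ≡⟨ cong (λ t → t + - c + c) (⁻¹-involutive x) ⟩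
    x + - c + c           ≡⟨ //-rightDividesˡ c x ⟩
    x                     ∎
    where open ≡-Reasoning

  act-injective : ∀ s c {x y} → act A s c x ≡ act A s c y → x ≡ y
  act-injective s c {x} {y} p =
    trans (sym (act-inverse s c x)) (trans (cong (act A s (offset⁻¹ s c)) p) (act-inverse s c y))

  act-0#-nonzero : ∀ s {x} → ¬ x ≡ 0# → ¬ act A s 0# x ≡ 0#
  act-0#-nonzero s x≢0 p = x≢0 (act-injective s 0# (trans p (sym (act-0# s 0#))))

  image-id : ∀ X → SameSet A X (Image A (act A plus 0#) X)
  image-id X y = mk⇔ (λ Xy → y , Xy , sym (identityʳ y))
                     (λ { (x , Xx , y≡x+0) → subst X (sym (trans y≡x+0 (identityʳ x))) Xx })

  translate-preimage : ∀ {X Y} s c x → SameSet A Y (Image A (act A plus c) X) → Y (act A s c x) → X (act A s 0# x)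
  translate-preimage {X} s c x Y≐c+X Y[gx] with Equivalence.to (Y≐c+X _) Y[gx]
  ... | z , Xz , gx≡z+c = subst X (sym (act-injective plus c (trans (sym (act-linear-part s c x)) gx≡z+c))) Xz

  ECond-swap : ∀ {a b} → ECond A a b → ECond A b a
  ECond-swap (2a≢0 , 2b≢0 , disjoint) = 2b≢0 , 2a≢0 , λ x p q → disjoint x q p

  ECond-negˡ : ∀ {a b} → ECond A a b → ECond A (- a) b
  ECond-negˡ {a} (2a≢0 , 2b≢0 , disjoint) =
    (λ -a+-a≡0 → 2a≢0 (⁻¹-injective (trans (-[x+x]≡-x+-x a) (trans -a+-a≡0 (sym ε⁻¹≈ε))))) ,
    2b≢0 , λ x p q → disjoint x (multiples-of-neg x p) q
    where
      multiples-of-neg : ∀ x → x ≡ - a ⊎ x ≡ - - a ⊎ x ≡ - a + - a ⊎ x ≡ - (- a + - a) →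
                               x ≡ a ⊎ x ≡ - a ⊎ x ≡ a + a ⊎ x ≡ - (a + a)
      multiples-of-neg x (inj₁ e)               = inj₂ (inj₁ e)
      multiples-of-neg x (inj₂ (inj₁ e))        = inj₁ (trans e (⁻¹-involutive a))
      multiples-of-neg x (inj₂ (inj₂ (inj₁ e))) = inj₂ (inj₂ (inj₂ (trans e (sym (-[x+x]≡-x+-x a)))))
      multiples-of-neg x (inj₂ (inj₂ (inj₂ e))) =
        inj₂ (inj₂ (inj₁ (trans e (trans (cong -_ (sym (-[x+x]≡-x+-x a))) (⁻¹-involutive (a + a))))))

  ECond-negʳ : ∀ {a b} → ECond A a b → ECond A a (- b)
  ECond-negʳ ec = ECond-swap (ECond-negˡ (ECond-swap ec))

  Quad-recentre-at-a : ∀ a b → SameSet A (Quad A a b) (Image A (act A plus a) (Quad A (- a) b))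
  Quad-recentre-at-a a b y = mk⇔ to from
    where
      to : Quad A a b y → Image A (act A plus a) (Quad A (- a) b) y
      to (inj₁ e)               = - a , quad-a , trans e (sym (inverseˡ a))
      to (inj₂ (inj₁ e))        = 0# , quad-0 , trans e (sym (identityˡ a))
      to (inj₂ (inj₂ (inj₁ e))) = - a + b , quad-a+b , trans e (sym (-x+y+x≡y a b))
      to (inj₂ (inj₂ (inj₂ e))) = b , quad-b , trans e (comm a b)
      from : Image A (act A plus a) (Quad A (- a) b) y → Quad A a b y
      from (_ , quad-0 , e)   = inj₂ (inj₁ (trans e (identityˡ a)))
      from (_ , quad-a , e)   = inj₁ (trans e (inverseˡ a))
      from (_ , quad-b , e)   = inj₂ (inj₂ (inj₂ (trans e (comm b a))))
      from (_ , quad-a+b , e) = inj₂ (inj₂ (inj₁ (trans e (-x+y+x≡y a b))))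

  Quad-recentre-at-b : ∀ a b → SameSet A (Quad A a b) (Image A (act A plus b) (Quad A a (- b)))
  Quad-recentre-at-b a b y = mk⇔ to from
    where
      to : Quad A a b y → Image A (act A plus b) (Quad A a (- b)) y
      to (inj₁ e)               = - b , quad-b , trans e (sym (inverseˡ b))
      to (inj₂ (inj₁ e))        = a + - b , quad-a+b , trans e (sym (//-rightDividesˡ b a))
      to (inj₂ (inj₂ (inj₁ e))) = 0# , quad-0 , trans e (sym (identityˡ b))
      to (inj₂ (inj₂ (inj₂ e))) = a , quad-a , e
      from : Image A (act A plus b) (Quad A a (- b)) y → Quad A a b y
      from (_ , quad-0 , e)   = inj₂ (inj₂ (inj₁ (trans e (identityˡ b))))
      from (_ , quad-a , e)   = inj₂ (inj₂ (inj₂ e))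
      from (_ , quad-b , e)   = inj₁ (trans e (inverseˡ b))
      from (_ , quad-a+b , e) = inj₂ (inj₁ (trans e (//-rightDividesˡ b a)))

  Quad-recentre-at-a+b : ∀ a b → SameSet A (Quad A a b) (Image A (act A plus (a + b)) (Quad A (- a) (- b)))
  Quad-recentre-at-a+b a b y = mk⇔ to from
    where
      to : Quad A a b y → Image A (act A plus (a + b)) (Quad A (- a) (- b)) y
      to (inj₁ e)               = - a + - b , quad-a+b , trans e (sym (-x+-y+[x+y]≡0 a b))
      to (inj₂ (inj₁ e))        = - b , quad-b , trans e (sym (-y+[x+y]≡x a b))
      to (inj₂ (inj₂ (inj₁ e))) = - a , quad-a , trans e (sym (\\-leftDividesʳ a b))
      to (inj₂ (inj₂ (inj₂ e))) = 0# , quad-0 , trans e (sym (identityˡ (a + b)))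
      from : Image A (act A plus (a + b)) (Quad A (- a) (- b)) y → Quad A a b y
      from (_ , quad-0 , e)   = inj₂ (inj₂ (inj₂ (trans e (identityˡ (a + b)))))
      from (_ , quad-a , e)   = inj₂ (inj₂ (inj₁ (trans e (\\-leftDividesʳ a b))))
      from (_ , quad-b , e)   = inj₂ (inj₁ (trans e (-y+[x+y]≡x a b)))
      from (_ , quad-a+b , e) = inj₁ (trans e (-x+-y+[x+y]≡0 a b))

  Quad-recentre : ∀ {a b c} → ECond A a b → Quad A a b c →
    ∃₂ λ a′ b′ → ECond A a′ b′ × SameSet A (Quad A a b) (Image A (act A plus c) (Quad A a′ b′))
  Quad-recentre {a} {b} ec quad-0   = a , b , ec , image-id (Quad A a b)
  Quad-recentre {a} {b} ec quad-a   = - a , b , ECond-negˡ ec , Quad-recentre-at-a a b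
  Quad-recentre {a} {b} ec quad-b   = a , - b , ECond-negʳ ec , Quad-recentre-at-b a b
  Quad-recentre {a} {b} ec quad-a+b = - a , - b , ECond-negʳ (ECond-negˡ ec) , Quad-recentre-at-a+b a b

  module _ {S : Subset A} (S-isSubgroup : IsSubgroup A S) where
    open IsSubgroup S-isSubgroup

    S-cancelˡ : ∀ {x y} → S x → S (x + y) → S y
    S-cancelˡ {x} {y} Sx Sx+y = subst S (\\-leftDividesʳ x y) (+-closed (neg-closed Sx) Sx+y)

    S-cancelʳ : ∀ {x y} → S y → S (x + y) → S x
    S-cancelʳ {x} {y} Sy Sx+y = subst S (//-rightDividesʳ y x) (+-closed Sx+y (neg-closed Sy))

    act-closed : ∀ s {c x} → S c → S x → S (act A s c x)
    act-closed plus  Sc Sx = +-closed Sx Sc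
    act-closed minus Sc Sx = +-closed (neg-closed Sx) Sc

    offset⁻¹-closed : ∀ s {c} → S c → S (offset⁻¹ s c)
    offset⁻¹-closed plus  Sc = neg-closed Sc
    offset⁻¹-closed minus Sc = Sc

    act-offset-closed : ∀ s {c x} → S x → S (act A s c x) → S c
    act-offset-closed s {c} {x} Sx Sgx =
      S-cancelˡ (act-closed s has-0 Sx) (subst S (act-linear-part s c x) Sgx)

    act-argument-closed : ∀ s {c x} → S c → S (act A s c x) → S x
    act-argument-closed s {c} {x} Sc Sgx =
      subst S (act-inverse s c x) (act-closed s (offset⁻¹-closed s Sc) Sgx)

    Triple⊆ : ∀ {a b} → S a → S b → ∀ x → Triple A a b x → S x
    Triple⊆ Sa Sb _ (inj₁ refl)        = has-0
    Triple⊆ Sa Sb _ (inj₂ (inj₁ refl)) = Sa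
    Triple⊆ Sa Sb _ (inj₂ (inj₂ refl)) = Sb

    Quad⊆ : ∀ {a b} → S a → S b → ∀ x → Quad A a b x → S x
    Quad⊆ Sa Sb _ quad-0   = has-0
    Quad⊆ Sa Sb _ quad-a   = Sa
    Quad⊆ Sa Sb _ quad-b   = Sb
    Quad⊆ Sa Sb _ quad-a+b = +-closed Sa Sb

    Quad-generators-closed : ∀ {a b z₁ z₂} → S z₁ → S z₂ → ¬ z₁ ≡ 0# → ¬ z₂ ≡ 0# → ¬ z₁ ≡ z₂ →
                             Quad A a b z₁ → Quad A a b z₂ → S a × S b
    Quad-generators-closed _   _   z₁≢0 _    _     quad-0   _        = ⊥-elim (z₁≢0 refl)
    Quad-generators-closed _   _   _    z₂≢0 _     _        quad-0   = ⊥-elim (z₂≢0 refl)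
    Quad-generators-closed _   _   _    _    z₁≢z₂ quad-a   quad-a   = ⊥-elim (z₁≢z₂ refl)
    Quad-generators-closed _   _   _    _    z₁≢z₂ quad-b   quad-b   = ⊥-elim (z₁≢z₂ refl)
    Quad-generators-closed _   _   _    _    z₁≢z₂ quad-a+b quad-a+b = ⊥-elim (z₁≢z₂ refl)
    Quad-generators-closed Sa  Sb  _    _    _     quad-a   quad-b   = Sa , Sb
    Quad-generators-closed Sb  Sa  _    _    _     quad-b   quad-a   = Sa , Sb
    Quad-generators-closed Sa  Sab _    _    _     quad-a   quad-a+b = Sa , S-cancelˡ Sa Sab
    Quad-generators-closed Sab Sa  _    _    _     quad-a+b quad-a   = Sa , S-cancelˡ Sa Sab
    Quad-generators-closed Sb  Sab _    _    _     quad-b   quad-a+b = S-cancelʳ Sb Sab , Sb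
    Quad-generators-closed Sab Sb  _    _    _     quad-a+b quad-b   = S-cancelʳ Sb Sab , Sb

    InOrbit-refl : ∀ X → InOrbit A S X X
    InOrbit-refl X = plus , 0# , has-0 , image-id X

    InOrbit-sym : ∀ {X Y} → InOrbit A S X Y → InOrbit A S Y X
    InOrbit-sym {X} {Y} (s , c , Sc , Y≐gX) = s , offset⁻¹ s c , offset⁻¹-closed s Sc , λ x → mk⇔ (to x) (from x)
      where
        to : ∀ x → X x → Image A (act A s (offset⁻¹ s c)) Y x
        to x Xx = act A s c x , Equivalence.from (Y≐gX _) (x , Xx , refl) , sym (act-inverse s c x)
        from : ∀ x → Image A (act A s (offset⁻¹ s c)) Y x → X x
        from x (y , Yy , x≡g⁻¹y) with Equivalence.to (Y≐gX y) Yy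
        ... | x₀ , Xx₀ , y≡gx₀ =
          subst X (sym (trans x≡g⁻¹y (trans (cong (act A s (offset⁻¹ s c)) y≡gx₀) (act-inverse s c x₀)))) Xx₀

    InOrbit-trans : ∀ {X Y Z} → InOrbit A S X Y → InOrbit A S Y Z → InOrbit A S X Z
    InOrbit-trans {X} {Y} {Z} (s , c , Sc , Y≐gX) (s′ , c′ , Sc′ , Z≐g′Y) =
      s′ ⊙ s , act A s′ c′ c , act-closed s′ Sc′ Sc , λ z → mk⇔ (to z) (from z)
      where
        to : ∀ z → Z z → Image A (act A (s′ ⊙ s) (act A s′ c′ c)) X z
        to z Zz with Equivalence.to (Z≐g′Y z) Zz
        ... | y , Yy , z≡g′y with Equivalence.to (Y≐gX y) Yy
        ... | x , Xx , y≡gx = x , Xx , trans z≡g′y (trans (cong (act A s′ c′) y≡gx) (act-∘ s′ c′ s c x))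
        from : ∀ z → Image A (act A (s′ ⊙ s) (act A s′ c′ c)) X z → Z z
        from z (x , Xx , z≡g′gx) = Equivalence.from (Z≐g′Y z)
          (act A s c x , Equivalence.from (Y≐gX _) (x , Xx , refl) , trans z≡g′gx (sym (act-∘ s′ c′ s c x)))

    Incident : Subset A → Subset A → Set
    Incident T Q = ∃ λ s → ∃ λ c → S c × (∀ x → T x → Q (act A s c x))

    Incident-respˡ : ∀ {T T′ Q} → InOrbit A S T T′ → Incident T Q → Incident T′ Q
    Incident-respˡ {T} {T′} {Q} (s′ , c′ , Sc′ , T′≐g′T) (s , c , Sc , gT⊆Q) =
      s ⊙ s′ , act A s c (offset⁻¹ s′ c′) , act-closed s Sc (offset⁻¹-closed s′ Sc′) , gg′⁻¹T′⊆Q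
      where
        gg′⁻¹T′⊆Q : ∀ x → T′ x → Q (act A (s ⊙ s′) (act A s c (offset⁻¹ s′ c′)) x)
        gg′⁻¹T′⊆Q x T′x with Equivalence.to (T′≐g′T x) T′x
        ... | t , Tt , x≡g′t = subst Q
          (trans (cong (act A s c) (sym (trans (cong (act A s′ (offset⁻¹ s′ c′)) x≡g′t) (act-inverse s′ c′ t))))
                 (act-∘ s c s′ (offset⁻¹ s′ c′) x))
          (gT⊆Q t Tt)

    Incident-respʳ : ∀ {T Q Q′} → InOrbit A S Q Q′ → Incident T Q → Incident T Q′
    Incident-respʳ {Q′ = Q′} (s′ , c′ , Sc′ , Q′≐g′Q) (s , c , Sc , gT⊆Q) =
      s′ ⊙ s , act A s′ c′ c , act-closed s′ Sc′ Sc ,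
      λ x Tx → subst Q′ (act-∘ s′ c′ s c x) (Equivalence.from (Q′≐g′Q _) (act A s c x , gT⊆Q x Tx , refl))

    Köhler-isSetoidGraph : IsSetoidGraph (Köhler A S)
    Köhler-isSetoidGraph = record
      { ≈V-isEquivalence = record { refl = InOrbit-refl _ ; sym = InOrbit-sym ; trans = InOrbit-trans }
      ; ≈E-isEquivalence = record { refl = InOrbit-refl _ ; sym = InOrbit-sym ; trans = InOrbit-trans }
      ; ∈E-respˡ = λ {_} {_} {e} → Incident-respˡ {Q = Quad A (KEdge.a e) (KEdge.b e)}
      ; ∈E-respʳ = λ {u} → Incident-respʳ {T = Triple A (KVertex.a u) (KVertex.b u)}
      }

    Quad-offset-closed : ∀ {a b} s c → S a → S b → Quad A a b (act A s c 0#) → S c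
    Quad-offset-closed s c Sa Sb q = act-offset-closed s has-0 (Quad⊆ Sa Sb _ q)

    InOrbit-fromWhole : ∀ {X Y} → (∀ x → X x → S x) → Y 0# → InOrbit A (Whole A) X Y → InOrbit A S X Y
    InOrbit-fromWhole X⊆S Y0 (s , c , _ , Y≐gX) with Equivalence.to (Y≐gX 0#) Y0
    ... | x , Xx , 0≡gx = s , c , act-offset-closed s (X⊆S x Xx) (subst S 0≡gx has-0) , Y≐gX

    inclusionV : KVertex A S → KVertex A (Whole A)
    inclusionV (kv a b _ _ cond) = kv a b tt tt cond

    inclusionE : KEdge A S → KEdge A (Whole A)
    inclusionE (ke a b _ _ cond) = ke a b tt tt cond

    private
      module W = Graph (Köhler A (Whole A))

    inclusion-closedV : ∀ u e → u W.∈E inclusionE e → ∃ λ u′ → inclusionV u′ W.≈V u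
    inclusion-closedV (kv a b _ _ cond) (ke _ _ Sa′ Sb′ _) (s , c , _ , gT⊆Q) =
      kv a b (in-S (inj₂ (inj₁ refl))) (in-S (inj₂ (inj₂ refl))) cond , plus , 0# , tt , image-id _
      where
        Sc : S c
        Sc = Quad-offset-closed s c Sa′ Sb′ (gT⊆Q 0# (inj₁ refl))
        in-S : ∀ {x} → Triple A a b x → S x
        in-S {x} p = act-argument-closed s Sc (Quad⊆ Sa′ Sb′ _ (gT⊆Q x p))

    inclusion-closedE : ∀ u e → inclusionV u W.∈E e → ∃ λ e′ → inclusionE e′ W.≈E e
    inclusion-closedE (kv u₁ u₂ Su₁ Su₂ (u₁≢u₂ , _ , 2u₁≢0 , _ , _ , 2u₂≢0 , _)) (ke a b _ _ ec) (s , c , _ , gT⊆Q)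
      with Quad-recentre ec (subst (Quad A a b) (act-0# s c) (gT⊆Q 0# (inj₁ refl)))
    ... | a′ , b′ , ec′ , Q≐c+Q′ = ke a′ b′ (proj₁ Sa′×Sb′) (proj₂ Sa′×Sb′) ec′ , plus , c , tt , Q≐c+Q′
      where
        image∈Q′ : ∀ {u} → Triple A u₁ u₂ u → Quad A a′ b′ (act A s 0# u)
        image∈Q′ {u} p = translate-preimage s c u Q≐c+Q′ (gT⊆Q u p)
        Sa′×Sb′ : S a′ × S b′
        Sa′×Sb′ = Quad-generators-closed (act-closed s has-0 Su₁) (act-closed s has-0 Su₂)
          (act-0#-nonzero s (x+x≢0⇒x≢0 2u₁≢0)) (act-0#-nonzero s (x+x≢0⇒x≢0 2u₂≢0))
          (λ p → u₁≢u₂ (act-injective s 0# p))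
          (image∈Q′ (inj₂ (inj₁ refl))) (image∈Q′ (inj₂ (inj₂ refl)))

    subgroup-embedding : IsoToUnionOfComponents (Köhler A S) (Köhler A (Whole A))
    subgroup-embedding = record
      { fV      = inclusionV
      ; fE      = inclusionE
      ; fV-cong = λ { (s , c , _ , Y≐gX) → s , c , tt , Y≐gX }
      ; fV-inj  = λ { {kv _ _ Sa Sb _} → InOrbit-fromWhole (Triple⊆ Sa Sb) (inj₁ refl) }
      ; fE-cong = λ { (s , c , _ , Y≐gX) → s , c , tt , Y≐gX }
      ; fE-inj  = λ { {ke _ _ Sa Sb _} → InOrbit-fromWhole (Quad⊆ Sa Sb) (inj₁ refl) }
      ; inc     = λ { u (ke _ _ Sa Sb _) → mk⇔
          (λ { (s , c , _ , gT⊆Q) → s , c , tt , gT⊆Q })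
          (λ { (s , c , _ , gT⊆Q) → s , c , Quad-offset-closed s c Sa Sb (gT⊆Q 0# (inj₁ refl)) , gT⊆Q }) }
      ; closedE = inclusion-closedE
      ; closedV = inclusion-closedV
      }

  Whole-isSubgroup : IsSubgroup A (Whole A)
  Whole-isSubgroup = record { has-0 = tt ; +-closed = λ _ _ → tt ; neg-closed = λ _ → tt }

  ·ℕ-homo-+ : ∀ m n x → _·ℕ_ A (m ℕ.+ n) x ≡ _·ℕ_ A m x + _·ℕ_ A n x
  ·ℕ-homo-+ zero    n x = sym (identityˡ _)
  ·ℕ-homo-+ (suc m) n x = trans (cong (x +_) (·ℕ-homo-+ m n x)) (sym (assoc x _ _))

  [x+p]+-[x+q]≡p+-q : ∀ x p q → x + p + - (x + q) ≡ p + - q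
  [x+p]+-[x+q]≡p+-q x p q = begin
    x + p + - (x + q)       ≡⟨ cong (x + p +_) (sym (⁻¹-∙-comm x q)) ⟩
    x + p + (- x + - q)     ≡⟨ interchange x p (- x) (- q) ⟩
    x + - x + (p + - q)     ≡⟨ cong (_+ (p + - q)) (inverseʳ x) ⟩
    0# + (p + - q)          ≡⟨ identityˡ _ ⟩
    p + - q                 ∎
    where open ≡-Reasoning

  ·ℤ-homo-⊖ : ∀ m n x → _·ℤ_ A (m ⊖ n) x ≡ _·ℕ_ A m x + - _·ℕ_ A n x
  ·ℤ-homo-⊖ zero    zero    x = sym (inverseʳ 0#)
  ·ℤ-homo-⊖ zero    (suc n) x = sym (identityˡ _)
  ·ℤ-homo-⊖ (suc m) zero    x = sym (trans (cong (_·ℕ_ A (suc m) x +_) ε⁻¹≈ε) (identityʳ _))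
  ·ℤ-homo-⊖ (suc m) (suc n) x = begin
    _·ℤ_ A (suc m ⊖ suc n) x               ≡⟨ cong (λ k → _·ℤ_ A k x) (ℤ.[1+m]⊖[1+n]≡m⊖n m n) ⟩
    _·ℤ_ A (m ⊖ n) x                       ≡⟨ ·ℤ-homo-⊖ m n x ⟩
    _·ℕ_ A m x + - _·ℕ_ A n x              ≡⟨ sym ([x+p]+-[x+q]≡p+-q x _ _) ⟩
    x + _·ℕ_ A m x + - (x + _·ℕ_ A n x)    ∎
    where open ≡-Reasoning

  ·ℤ-homo-+ : ∀ m n x → _·ℤ_ A (m ℤ.+ n) x ≡ _·ℤ_ A m x + _·ℤ_ A n x
  ·ℤ-homo-+ (ℤ.+ m)  (ℤ.+ n)  x = ·ℕ-homo-+ m n x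
  ·ℤ-homo-+ (ℤ.+ m)  -[1+ n ] x = ·ℤ-homo-⊖ m (suc n) x
  ·ℤ-homo-+ -[1+ m ] (ℤ.+ n)  x = trans (·ℤ-homo-⊖ n (suc m) x) (comm _ _)
  ·ℤ-homo-+ -[1+ m ] -[1+ n ] x = begin
    - _·ℕ_ A (suc (suc (m ℕ.+ n))) x                ≡⟨ cong (λ k → - _·ℕ_ A (suc k) x) (sym (ℕ.+-suc m n)) ⟩
    - _·ℕ_ A (suc m ℕ.+ suc n) x                    ≡⟨ cong -_ (·ℕ-homo-+ (suc m) (suc n) x) ⟩
    - (_·ℕ_ A (suc m) x + _·ℕ_ A (suc n) x)         ≡⟨ sym (⁻¹-∙-comm _ _) ⟩
    - _·ℕ_ A (suc m) x + - _·ℕ_ A (suc n) x         ∎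
    where open ≡-Reasoning

  ·ℤ-homo-neg : ∀ m x → _·ℤ_ A (ℤ.- m) x ≡ - _·ℤ_ A m x
  ·ℤ-homo-neg (ℤ.+ zero)  x = sym ε⁻¹≈ε
  ·ℤ-homo-neg (ℤ.+ suc n) x = refl
  ·ℤ-homo-neg -[1+ n ]    x = sym (⁻¹-involutive _)

  Generated-isSubgroup : ∀ a b → IsSubgroup A (Generated A a b)
  Generated-isSubgroup a b = record
    { has-0      = ℤ.+ 0 , ℤ.+ 0 , sym (identityˡ 0#)
    ; +-closed   = λ { (m , n , x≡ma+nb) (m′ , n′ , y≡m′a+n′b) → m ℤ.+ m′ , n ℤ.+ n′ ,
        trans (cong₂ _+_ x≡ma+nb y≡m′a+n′b)
          (trans (interchange _ _ _ _) (sym (cong₂ _+_ (·ℤ-homo-+ m m′ a) (·ℤ-homo-+ n n′ b)))) }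
    ; neg-closed = λ { (m , n , x≡ma+nb) → ℤ.- m , ℤ.- n ,
        trans (cong -_ x≡ma+nb)
          (trans (sym (⁻¹-∙-comm _ _)) (sym (cong₂ _+_ (·ℤ-homo-neg m a) (·ℤ-homo-neg n b)))) }
    }

  component-in-generated : (v : KVertex A (Whole A)) → ∃₂ λ a b → ∃ λ w →
    Iso (Component (Köhler A (Whole A)) v) (Component (Köhler A (Generated A a b)) w)
  component-in-generated (kv a b _ _ cond) =
    a , b , kv a b a∈⟨a,b⟩ b∈⟨a,b⟩ cond ,
    component-iso (InOrbit-refl ⟨a,b⟩-isSubgroup _) (Köhler-isSetoidGraph Whole-isSubgroup)
                  (subgroup-embedding ⟨a,b⟩-isSubgroup) (InOrbit-refl Whole-isSubgroup _)
    where
      ⟨a,b⟩-isSubgroup = Generated-isSubgroup a b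
      a∈⟨a,b⟩ : Generated A a b a
      a∈⟨a,b⟩ = ℤ.+ 1 , ℤ.+ 0 , sym (trans (identityʳ _) (identityʳ a))
      b∈⟨a,b⟩ : Generated A a b b
      b∈⟨a,b⟩ = ℤ.+ 0 , ℤ.+ 1 , sym (trans (identityˡ _) (identityʳ b))

lemma3p8 : (A : FinAbGroup) →
    ((S : Subset A) → IsSubgroup A S →
    IsoToUnionOfComponents (Köhler A S) (Köhler A (Whole A)))
    ×
    ((v : Graph.V (Köhler A (Whole A))) →
    ∃₂ λ a b → ∃ λ w →
    Iso (Component (Köhler A (Whole A)) v)
    (Component (Köhler A (Generated A a b)) w))
lemma3p8 A = (λ _ → subgroup-embedding) , component-in-generated
  where open KöhlerGraph A
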